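{- Let $H$ be a bipartite graph and let $(G,L,N_0,k)$ be an instance of FS-FC-IG($H$). Let $G'$ be obtained from $G$ by adding a new vertex $s$ adjacent to every vertex of $N_0$. Among all solutions of minimum size, fix a solution $W$ for which $R_{G'\setminus W}(\{s\})$ has the smallest possible size, and set $R=R_{G'\setminus W}(\{s\})$. Then $W=N(R)$ (neighborhood taken in $G'$), and $R$ is an $\{s\}$-closest set in $G'$.
   Context: All graphs are finite, undirected, without loops or parallel edges. A list homomorphism from $(G,L)$ to $H$ is a map $\phi:V(G)\to V(H)$ mapping edges to edges with $\phi(v)\in L(v)$ for all $v$. For bipartite $H$, a list $L(v)$ is fixed side fixed component if it is contained in one side of a single connected component of $H$. FS-FC-IG($H$): given a graph $G$, a list function $L:V(G)\to 2^{V(H)}$ in which every list is fixed side fixed component, a set $N_0\subseteq V(G)$, and an integer $k$, decide whether there is $W\subseteq V(G)$ with $|W|\le k$ such that for every connected component $C$ of $G\setminus W$ with $C\cap N_0\ne\emptyset$, $(G[C],L|_C)$ has a list homomorphism to $H$; such $W$ is a solution. For $A,X\subseteq V(G)$, $R_{G\setminus X}(A)$ denotes the set of vertices reachable from a vertex of $A$ in $G\setminus X$. $N(R)$ denotes the set of vertices not in $R$ having a neighbor in $R$. For $S\subseteq V(G)$, a set $R\supseteq S$ is $S$-closest if there is no $R'\subsetneq R$ with $S\subseteq R'$ and $|N(R)|\ge |N(R')|$. -}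

module Defs where

open import Data.Bool using (Bool; true; false; not; _∧_; _∨_)
open import Data.Nat using (ℕ; zero; suc; _≤_)
open import Data.Fin using (Fin; zero; suc)
open import Data.Vec using (Vec; _∷_; []; tabulate; lookup)
open import Data.Fin.Subset using (Subset; _∈_; _∉_; _⊆_; _⊂_; ⁅_⁆; ∣_∣; ⊥)
open import Data.Product using (Σ; ∃; ∃-syntax; _×_; _,_)
open import Relation.Binary.PropositionalEquality using (_≡_)
open import Relation.Nullary using (¬_)

record Graph (n : ℕ) : Set where
  field
    adj   : Fin n → Fin n → Bool
    sym   : ∀ u v → adj u v ≡ adj v u
    loopless : ∀ v → adj v v ≡ false
open Graph public

Edge : ∀ {n} → Graph n → Fin n → Fin n → Set
Edge G u v = adj G u v ≡ true

-- Reachability: Reach G X A v  means  v ∈ R_{G∖X}(A), i.e. v is reachable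
-- from a vertex of A by a walk in G all of whose vertices avoid X.

data Reach {n} (G : Graph n) (X A : Subset n) : Fin n → Set where
  base : ∀ {a} → a ∈ A → a ∉ X → Reach G X A a
  step : ∀ {u v} → Reach G X A u → Edge G u v → v ∉ X → Reach G X A v

anyFin : ∀ {n} → (Fin n → Bool) → Bool
anyFin {zero}  p = false
anyFin {suc n} p = p zero ∨ anyFin {n} (λ i → p (suc i))

nbhd : ∀ {n} → Graph n → Subset n → Subset n
nbhd G R = tabulate λ v → not (lookup R v) ∧ anyFin (λ u → lookup R u ∧ adj G u v)

Closest : ∀ {n} → Graph n → Subset n → Subset n → Set
Closest G S R =
  S ⊆ R × (∀ R' → S ⊆ R' → R' ⊂ R → ¬ (∣ nbhd G R' ∣ ≤ ∣ nbhd G R ∣))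

ProperTwoColouring : ∀ {h} → Graph h → (Fin h → Bool) → Set
ProperTwoColouring H col = ∀ u v → Edge H u v → ¬ (col u ≡ col v)

Bipartite : ∀ {h} → Graph h → Set
Bipartite H = ∃[ col ] ProperTwoColouring H col

Connected : ∀ {h} → Graph h → Fin h → Fin h → Set
Connected H x v = Reach H ⊥ ⁅ x ⁆ v

-- The list is contained in one side (colour class of a bipartition) of a
-- single connected component of H.
FSFC : ∀ {h} → Graph h → Subset h → Set
FSFC H l = ∃[ col ] ProperTwoColouring H col ×
           ∃[ x ] ∃[ b ] (∀ v → v ∈ l → Connected H x v × col v ≡ b)

-- List homomorphism of (G[C], L|C) to H, where C is a vertex set given as
-- a predicate.  (φ is total on V(G) but only constrained on C.)

ListHomOn : ∀ {n h} → Graph n → (Fin n → Subset h) → Graph h →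
            (Fin n → Set) → Set
ListHomOn {n} {h} G L H C = Σ (Fin n → Fin h) λ φ →
  ((∀ v → C v → φ v ∈ L v) ×
   (∀ u v → C u → C v → Edge G u v → Edge H (φ u) (φ v)))

-- Every connected component C of G∖W (C = R_{G∖W}({v}) for some v ∉ W)
-- with C ∩ N₀ ≠ ∅ admits a list homomorphism (G[C], L|C) → H.
ComponentsOK : ∀ {n h} → Graph h → Graph n → (Fin n → Subset h) →
               Subset n → Subset n → Set
ComponentsOK H G L N₀ W =
  ∀ v → v ∉ W → (∃[ u ] (u ∈ N₀ × Reach G W ⁅ v ⁆ u)) →
  ListHomOn G L H (Reach G W ⁅ v ⁆)

Solution : ∀ {n h} → Graph h → Graph n → (Fin n → Subset h) →
           Subset n → ℕ → Subset n → Set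
Solution H G L N₀ k W = ∣ W ∣ ≤ k × ComponentsOK H G L N₀ W

MinSolution : ∀ {n h} → Graph h → Graph n → (Fin n → Subset h) →
              Subset n → ℕ → Subset n → Set
MinSolution H G L N₀ k W =
  Solution H G L N₀ k W × (∀ W' → Solution H G L N₀ k W' → ∣ W ∣ ≤ ∣ W' ∣)

-- G' = G plus a new vertex s (= zero) adjacent exactly to N₀.
-- Old vertex v of G is suc v in G'.

addAdj : ∀ {n} → Graph n → Subset n → Fin (suc n) → Fin (suc n) → Bool
addAdj G N₀ zero    zero    = false
addAdj G N₀ zero    (suc v) = lookup N₀ v
addAdj G N₀ (suc u) zero    = lookup N₀ u
addAdj G N₀ (suc u) (suc v) = adj G u v

addSym : ∀ {n} (G : Graph n) (N₀ : Subset n) u v →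
         addAdj G N₀ u v ≡ addAdj G N₀ v u
addSym G N₀ zero    zero    = Relation.Binary.PropositionalEquality.refl
addSym G N₀ zero    (suc v) = Relation.Binary.PropositionalEquality.refl
addSym G N₀ (suc u) zero    = Relation.Binary.PropositionalEquality.refl
addSym G N₀ (suc u) (suc v) = sym G u v

addLoop : ∀ {n} (G : Graph n) (N₀ : Subset n) v → addAdj G N₀ v v ≡ false
addLoop G N₀ zero    = Relation.Binary.PropositionalEquality.refl
addLoop G N₀ (suc v) = loopless G v

addApex : ∀ {n} → Graph n → Subset n → Graph (suc n)
addApex G N₀ = record { adj = addAdj G N₀ ; sym = addSym G N₀ ; loopless = addLoop G N₀ }

lift : ∀ {n} → Subset n → Subset (suc n)
lift W = false ∷ W

s : ∀ {n} → Fin (suc n)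
s = zero

IsReachSet : ∀ {n} → Graph n → Subset n → Subset n → Subset n → Set
IsReachSet G X A R = ∀ v → (v ∈ R → Reach G X A v) × (Reach G X A v → v ∈ R)

-- Let R = R_{G'∖W}(s). No vertex of N(R) can avoid W, since R is closed in G'∖W.
-- Conversely, if some w ∈ W had no neighbour in R, then R would still be closed in
-- G'∖(W ∖ w); the components of G ∖ (W ∖ w) meeting N₀ would lie in R, hence avoid W,
-- hence be contained in components of G ∖ W, so W ∖ w would be a smaller solution.
-- The same transfer shows R is {s}-closest: if s ∈ R' ⊊ R with |N(R')| ≤ |N(R)| = |W|,
-- then N(R') is a minimum solution whose reach set lies in R', contradicting the choice of W.
module Submission where

open import Defs
open import Data.Nat using (ℕ; suc; _≤_)
open import Data.Fin using (Fin)
open import Data.Fin.Subset using (Subset; ⁅_⁆; ∣_∣)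
open import Data.Product using (_×_)
open import Relation.Binary.PropositionalEquality using (_≡_)

open import Data.Bool using (Bool; true; false; not; _∧_; _∨_)
open import Data.Bool.Properties using (∨-zeroʳ; ∧-conicalˡ; ∧-conicalʳ)
open import Data.Nat using (zero; _+_; _<_)
open import Data.Nat.Properties
  using (≤-trans; <⇒≤; <⇒≱; m≤m+n; +-suc; +-monoʳ-≤; module ≤-Reasoning)
open import Data.Fin using (zero; suc; _≟_)
open import Data.Fin.Subset using (_∈_; _∉_; _⊆_; _⊂_; _∪_; _∩_; ∁; _-_)
open import Data.Fin.Subset.Properties
  using (_∈?_; _⊂?_; x∈⁅x⁆; x∈⁅y⁆⇒x≡y; ⊆-trans; ⊆-⊂-trans; ⊆-antisym; ∣p∣≤n;
         p⊂q⇒∣p∣<∣q∣; x∈p⇒∣p-x∣<∣p∣; x∈p∧x≢y⇒x∈p-y; drop-there;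
         x∈p∪q⁺; x∈p∪q⁻; x∈p∩q⁺; x∈p∩q⁻; x∉p⇒x∈∁p; x∈∁p⇒x∉p)
open import Data.Vec using (_∷_; lookup; tail; here; there)
open import Data.Vec.Properties using (lookup∘tabulate; []=⇒lookup; lookup⇒[]=)
open import Data.Product using (∃; _,_; proj₁; proj₂)
open import Data.Sum using (inj₁; inj₂)
open import Function using (_∘_)
open import Relation.Nullary using (¬_; yes; no; contradiction)
open import Relation.Binary.PropositionalEquality
  using (refl; trans; cong; cong₂; subst; module ≡-Reasoning)
  renaming (sym to ≡-sym)

private
  variable
    m : ℕ

∉⇒lookup≡false : ∀ {p : Subset m} {x} → x ∉ p → lookup p x ≡ false
∉⇒lookup≡false {p = p} {x} x∉p with lookup p x in eq
... | true  = contradiction (lookup⇒[]= x p eq) x∉p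
... | false = refl

⁅⁆⊆ : ∀ {p : Subset m} {x} → x ∈ p → ⁅ x ⁆ ⊆ p
⁅⁆⊆ {x = x} x∈p y∈⁅x⁆ with refl ← x∈⁅y⁆⇒x≡y x y∈⁅x⁆ = x∈p

⊆∧⊄⇒⊇ : ∀ {p q : Subset m} → p ⊆ q → ¬ p ⊂ q → q ⊆ p
⊆∧⊄⇒⊇ {p = p} p⊆q p⊄q {x} x∈q with x ∈? p
... | yes x∈p = x∈p
... | no  x∉p = contradiction ((λ {y} → p⊆q {y}) , x , x∈q , x∉p) p⊄q

lift-tail : ∀ {p : Subset (suc m)} → zero ∉ p → lift (tail p) ≡ p
lift-tail {p = false ∷ p} _   = refl
lift-tail {p = true  ∷ p} 0∉p = contradiction here 0∉p

anyFin⁺ : (p : Fin m → Bool) (i : Fin m) → p i ≡ true → anyFin p ≡ true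
anyFin⁺ p zero    pi≡true = cong (_∨ anyFin (p ∘ suc)) pi≡true
anyFin⁺ p (suc i) pi≡true =
  trans (cong (p zero ∨_) (anyFin⁺ (p ∘ suc) i pi≡true)) (∨-zeroʳ (p zero))

anyFin⁻ : (p : Fin m → Bool) → anyFin p ≡ true → ∃ λ i → p i ≡ true
anyFin⁻ {zero}  p ()
anyFin⁻ {suc m} p any with p zero in eq
... | true  = zero , eq
... | false with i , pi≡true ← anyFin⁻ (p ∘ suc) any = suc i , pi≡true

module _ (K : Graph m) where

  ∈-nbhd⁺ : ∀ {T u v} → v ∉ T → u ∈ T → Edge K u v → v ∈ nbhd K T
  ∈-nbhd⁺ {T} {u} {v} v∉T u∈T uv = lookup⇒[]= v (nbhd K T) (begin
    lookup (nbhd K T) v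
      ≡⟨ lookup∘tabulate _ v ⟩
    not (lookup T v) ∧ anyFin (λ w → lookup T w ∧ adj K w v)
      ≡⟨ cong₂ _∧_ (cong not (∉⇒lookup≡false v∉T))
                   (anyFin⁺ _ u (cong₂ _∧_ ([]=⇒lookup u∈T) uv)) ⟩
    true ∎)
    where open ≡-Reasoning

  ∈-nbhd⁻ : ∀ {T v} → v ∈ nbhd K T → v ∉ T × ∃ λ u → u ∈ T × Edge K u v
  ∈-nbhd⁻ {T} {v} v∈N =
    let u , u-ok = anyFin⁻ _ (∧-conicalʳ _ _ unfolded)
    in v∉T , u , lookup⇒[]= u T (∧-conicalˡ _ _ u-ok) , ∧-conicalʳ _ _ u-ok
    where
    unfolded : not (lookup T v) ∧ anyFin (λ w → lookup T w ∧ adj K w v) ≡ true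
    unfolded = trans (≡-sym (lookup∘tabulate _ v)) ([]=⇒lookup v∈N)
    v∉T : v ∉ T
    v∉T v∈T = contradiction (trans (cong not (≡-sym ([]=⇒lookup v∈T))) (∧-conicalˡ _ _ unfolded)) λ ()

Closed : Graph m → Subset m → Subset m → Set
Closed K X T = ∀ {u v} → u ∈ T → Edge K u v → v ∉ X → v ∈ T

module _ {K : Graph m} where

  nbhd-closed : ∀ {T} → Closed K (nbhd K T) T
  nbhd-closed {T} {v = v} u∈T uv v∉N with v ∈? T
  ... | yes v∈T = v∈T
  ... | no  v∉T = contradiction (∈-nbhd⁺ K v∉T u∈T uv) v∉N

  nbhd-⊆ : ∀ {X T} → Closed K X T → nbhd K T ⊆ X
  nbhd-⊆ {X} closed {v} v∈N with v ∈? X | ∈-nbhd⁻ K v∈N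
  ... | yes v∈X | _                    = v∈X
  ... | no  v∉X | v∉T , u , u∈T , uv = contradiction (closed u∈T uv v∉X) v∉T

  Closed-minus : ∀ {X T x} → Closed K X T → (∀ {u} → u ∈ T → ¬ Edge K u x) →
                 Closed K (X - x) T
  Closed-minus {x = x} closed no-edge {v = v} u∈T uv v∉X-x with v ≟ x
  ... | yes refl = contradiction uv (no-edge u∈T)
  ... | no  v≢x  = closed u∈T uv (λ v∈X → v∉X-x (x∈p∧x≢y⇒x∈p-y v∈X v≢x))

  Reach-∉ : ∀ {X A v} → Reach K X A v → v ∉ X
  Reach-∉ (base _ a∉X)  = a∉X
  Reach-∉ (step _ _ v∉X) = v∉X

  Reach-closed : ∀ {X A T v} → (∀ {a} → a ∈ A → a ∉ X → a ∈ T) → Closed K X T →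
                 Reach K X A v → v ∈ T
  Reach-closed A⊆T closed (base a∈A a∉X)  = A⊆T a∈A a∉X
  Reach-closed A⊆T closed (step r uv v∉X) = closed (Reach-closed A⊆T closed r) uv v∉X

  Reach-weaken : ∀ {X Y A v} → (∀ {w} → Reach K Y A w → w ∉ X) →
                 Reach K Y A v → Reach K X A v
  Reach-weaken avoids r@(base a∈A _)   = base a∈A (avoids r)
  Reach-weaken avoids r@(step r′ uv _) = step (Reach-weaken avoids r′) uv (avoids r)

  Reach-trans : ∀ {X A u v} → Reach K X A u → Reach K X ⁅ u ⁆ v → Reach K X A v
  Reach-trans {u = u} r (base a∈⁅u⁆ _) with refl ← x∈⁅y⁆⇒x≡y u a∈⁅u⁆ = r
  Reach-trans r (step r′ uv v∉X) = step (Reach-trans r r′) uv v∉X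

  Reach-sym : ∀ {X u v} → Reach K X ⁅ u ⁆ v → Reach K X ⁅ v ⁆ u
  Reach-sym {u = u} (base a∈⁅u⁆ a∉X) with refl ← x∈⁅y⁆⇒x≡y u a∈⁅u⁆ = base (x∈⁅x⁆ u) a∉X
  Reach-sym (step {w} {v} r wv v∉X) =
    Reach-trans (step (base (x∈⁅x⁆ v) v∉X) (trans (sym K v w) wv) (Reach-∉ r)) (Reach-sym r)

  IsReachSet-closed : ∀ {X A R} → IsReachSet K X A R → Closed K X R
  IsReachSet-closed isR u∈R uv v∉X = proj₂ (isR _) (step (proj₁ (isR _) u∈R) uv v∉X)

  IsReachSet-∉ : ∀ {X A R v} → IsReachSet K X A R → v ∈ R → v ∉ X
  IsReachSet-∉ isR v∈R = Reach-∉ (proj₁ (isR _) v∈R)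

-- Iterating an inflationary f from p either reaches a closed set (f q ⊆ q) or
-- strictly grows, which can happen at most m times.
prefixedPoint-above : (f : Subset m → Subset m) → (∀ p → p ⊆ f p) →
                      (P : Subset m → Set) → (∀ {p} → P p → P (f p)) →
                      ∀ p → P p → ∃ λ q → P q × p ⊆ q × f q ⊆ q
prefixedPoint-above {m} f inflationary P preserved p Pp = go m p (m≤m+n m ∣ p ∣) Pp
  where
  spend : ∀ {fuel b c} → m ≤ suc fuel + b → b < c → m ≤ fuel + c
  spend {fuel} {b} {c} bound b<c = begin
    m                ≤⟨ bound ⟩
    suc (fuel + b)   ≡⟨ +-suc fuel b ⟨
    fuel + suc b     ≤⟨ +-monoʳ-≤ fuel b<c ⟩
    fuel + c         ∎
    where open ≤-Reasoning

  go : ∀ fuel p → m ≤ fuel + ∣ p ∣ → P p → ∃ λ q → P q × p ⊆ q × f q ⊆ q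
  go fuel p bound Pp with p ⊂? f p
  ... | no p⊄fp = p , Pp , (λ x∈p → x∈p) , ⊆∧⊄⇒⊇ (inflationary p) p⊄fp
  ... | yes p⊂fp with fuel
  ...   | zero = contradiction bound (<⇒≱ (≤-trans (p⊂q⇒∣p∣<∣q∣ p⊂fp) (∣p∣≤n (f p))))
  ...   | suc fuel′
          with q , Pq , fp⊆q , closed ← go fuel′ (f p) (spend bound (p⊂q⇒∣p∣<∣q∣ p⊂fp)) (preserved Pp)
          = q , Pq , ⊆-trans (inflationary p) fp⊆q , closed

module _ (K : Graph m) (X A : Subset m) where

  private
    expand : Subset m → Subset m
    expand T = T ∪ (nbhd K T ∩ ∁ X)

    Sound : Subset m → Set
    Sound T = ∀ {v} → v ∈ T → Reach K X A v

    start-sound : Sound (A ∩ ∁ X)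
    start-sound a∈ with a∈A , a∈∁X ← x∈p∩q⁻ A (∁ X) a∈ = base a∈A (x∈∁p⇒x∉p a∈∁X)

    expand-sound : ∀ {T} → Sound T → Sound (expand T)
    expand-sound {T} sound v∈ with x∈p∪q⁻ T _ v∈
    ... | inj₁ v∈T = sound v∈T
    ... | inj₂ v∈N∖X with v∈N , v∈∁X ← x∈p∩q⁻ (nbhd K T) (∁ X) v∈N∖X
                     with _ , u , u∈T , uv ← ∈-nbhd⁻ K v∈N =
      step (sound u∈T) uv (x∈∁p⇒x∉p v∈∁X)

    expand-closed : ∀ {T} → expand T ⊆ T → Closed K X T
    expand-closed {T} expand⊆T {v = v} u∈T uv v∉X with v ∈? T
    ... | yes v∈T = v∈T
    ... | no  v∉T = expand⊆T (x∈p∪q⁺ (inj₂ (x∈p∩q⁺ (∈-nbhd⁺ K v∉T u∈T uv , x∉p⇒x∈∁p v∉X))))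

  reachSet : ∃ λ R → IsReachSet K X A R
  reachSet
    with R , sound , start⊆R , expand⊆R ←
           prefixedPoint-above expand (λ _ → x∈p∪q⁺ ∘ inj₁) Sound expand-sound (A ∩ ∁ X) start-sound
    = R , λ v → sound ,
        Reach-closed (λ a∈A a∉X → start⊆R (x∈p∩q⁺ (a∈A , x∉p⇒x∈∁p a∉X))) (expand-closed expand⊆R)

ListHomOn-⊆ : ∀ {n h} {G : Graph n} {L : Fin n → Subset h} {H : Graph h} {C D : Fin n → Set} →
              (∀ {v} → C v → D v) → ListHomOn G L H D → ListHomOn G L H C
ListHomOn-⊆ C⊆D (φ , respects-lists , preserves-edges) =
  φ , (λ v → respects-lists v ∘ C⊆D) , (λ u v Cu Cv → preserves-edges u v (C⊆D Cu) (C⊆D Cv))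

module _ {n h} (H : Graph h) (G : Graph n) (L : Fin n → Subset h) (N₀ : Subset n) where

  private
    G′ : Graph (suc n)
    G′ = addApex G N₀

  suc∉lift : ∀ {Y : Subset n} {v} → v ∉ Y → suc v ∉ lift Y
  suc∉lift v∉Y = v∉Y ∘ drop-there

  Reach-apex : ∀ {Y u v} → u ∈ N₀ → Reach G Y ⁅ u ⁆ v → Reach G′ (lift Y) ⁅ s ⁆ (suc v)
  Reach-apex {u = u} u∈N₀ (base a∈⁅u⁆ a∉Y) with refl ← x∈⁅y⁆⇒x≡y u a∈⁅u⁆ =
    step (base here λ ()) ([]=⇒lookup u∈N₀) (suc∉lift a∉Y)
  Reach-apex u∈N₀ (step r uv v∉Y) = step (Reach-apex u∈N₀ r) uv (suc∉lift v∉Y)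

  ComponentsOK-⊆ : ∀ {X Y} →
    (∀ {u y} → u ∈ N₀ → Reach G Y ⁅ u ⁆ y → Reach G X ⁅ u ⁆ y) →
    ComponentsOK H G L N₀ X → ComponentsOK H G L N₀ Y
  ComponentsOK-⊆ {X} Y⊆X okX v _ (u , u∈N₀ , v↝u) =
    ListHomOn-⊆ {G = G} {L} {H} (λ v↝y → Y⊆X u∈N₀ (Reach-trans (Reach-sym v↝u) v↝y))
                (okX u (Reach-∉ u↝u) (u , u∈N₀ , u↝u))
    where
    u↝u : Reach G X ⁅ u ⁆ u
    u↝u = Y⊆X u∈N₀ (base (x∈⁅x⁆ u) (Reach-∉ v↝u))

  -- Every component of G ∖ Y meeting N₀ lies (shifted by suc) in T, hence avoids X.
  ComponentsOK-shrink : ∀ {X Y} (T : Subset (suc n)) → s ∈ T → Closed G′ (lift Y) T →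
    (∀ {v} → suc v ∈ T → v ∉ X) → ComponentsOK H G L N₀ X → ComponentsOK H G L N₀ Y
  ComponentsOK-shrink T s∈T closed avoids =
    ComponentsOK-⊆ λ u∈N₀ →
      Reach-weaken (avoids ∘ Reach-closed (λ a∈⁅s⁆ _ → ⁅⁆⊆ s∈T a∈⁅s⁆) closed ∘ Reach-apex u∈N₀)

  module _ {k : ℕ} {W : Subset n} (minW : MinSolution H G L N₀ k W)
           {R : Subset (suc n)} (isR : IsReachSet G′ (lift W) ⁅ s ⁆ R) where

    private
      s∈R : s ∈ R
      s∈R = proj₂ (isR s) (base here λ ())

      suc∈R⇒∉W : ∀ {v} → suc v ∈ R → v ∉ W
      suc∈R⇒∉W sv∈R v∈W = IsReachSet-∉ isR sv∈R (there v∈W)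

      okW : ComponentsOK H G L N₀ W
      okW = proj₂ (proj₁ minW)

    MinSolution-⊆-nbhd : lift W ⊆ nbhd G′ R
    MinSolution-⊆-nbhd {zero}  ()
    MinSolution-⊆-nbhd {suc w} (there w∈W) with suc w ∈? nbhd G′ R
    ... | yes w∈N = w∈N
    ... | no  w∉N = contradiction (proj₂ minW (W - w) (≤-trans (<⇒≤ smaller) (proj₁ (proj₁ minW)) , okW-w))
                                  (<⇒≱ smaller)
      where
      smaller : ∣ W - w ∣ < ∣ W ∣
      smaller = x∈p⇒∣p-x∣<∣p∣ w∈W
      no-edge : ∀ {u} → u ∈ R → ¬ Edge G′ u (suc w)
      no-edge u∈R uw = w∉N (∈-nbhd⁺ G′ (λ sw∈R → suc∈R⇒∉W sw∈R w∈W) u∈R uw)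
      okW-w : ComponentsOK H G L N₀ (W - w)
      okW-w = ComponentsOK-shrink R s∈R (Closed-minus {K = G′} (IsReachSet-closed isR) no-edge) suc∈R⇒∉W okW

    MinSolution-≤ : ∀ {Y} → ComponentsOK H G L N₀ Y → ∣ Y ∣ ≤ ∣ W ∣ → MinSolution H G L N₀ k Y
    MinSolution-≤ okY Y≤W =
      (≤-trans Y≤W (proj₁ (proj₁ minW)) , okY) , λ Z solZ → ≤-trans Y≤W (proj₂ minW Z solZ)

    reachSet-closest : lift W ≡ nbhd G′ R →
      (∀ W′ R′ → MinSolution H G L N₀ k W′ → IsReachSet G′ (lift W′) ⁅ s ⁆ R′ → ∣ R ∣ ≤ ∣ R′ ∣) →
      Closest G′ ⁅ s ⁆ R
    reachSet-closest W≡N minR = ⁅⁆⊆ s∈R , shrinking-R-grows-N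
      where
      shrinking-R-grows-N : ∀ R′ → ⁅ s ⁆ ⊆ R′ → R′ ⊂ R → ¬ (∣ nbhd G′ R′ ∣ ≤ ∣ nbhd G′ R ∣)
      shrinking-R-grows-N R′ s⊆R′ R′⊂R N′≤N =
        <⇒≱ (p⊂q⇒∣p∣<∣q∣ (⊆-⊂-trans R″⊆R′ R′⊂R)) (minR W′ R″ minW′ isR″)
        where
        s∈R′ : s ∈ R′
        s∈R′ = s⊆R′ (x∈⁅x⁆ s)
        W′ : Subset n
        W′ = tail (nbhd G′ R′)
        liftW′≡N′ : lift W′ ≡ nbhd G′ R′
        liftW′≡N′ = lift-tail (λ s∈N′ → proj₁ (∈-nbhd⁻ G′ s∈N′) s∈R′)
        closed′ : Closed G′ (lift W′) R′
        closed′ = subst (λ X → Closed G′ X R′) (≡-sym liftW′≡N′) (nbhd-closed {K = G′})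
        W′≤W : ∣ W′ ∣ ≤ ∣ W ∣
        W′≤W = begin
          ∣ lift W′ ∣       ≡⟨ cong ∣_∣ liftW′≡N′ ⟩
          ∣ nbhd G′ R′ ∣    ≤⟨ N′≤N ⟩
          ∣ nbhd G′ R ∣     ≡⟨ cong ∣_∣ W≡N ⟨
          ∣ lift W ∣        ∎
          where open ≤-Reasoning
        minW′ : MinSolution H G L N₀ k W′
        minW′ = MinSolution-≤ (ComponentsOK-shrink R′ s∈R′ closed′ (suc∈R⇒∉W ∘ proj₁ R′⊂R) okW) W′≤W
        R″ : Subset (suc n)
        R″ = proj₁ (reachSet G′ (lift W′) ⁅ s ⁆)
        isR″ : IsReachSet G′ (lift W′) ⁅ s ⁆ R″
        isR″ = proj₂ (reachSet G′ (lift W′) ⁅ s ⁆)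
        R″⊆R′ : R″ ⊆ R′
        R″⊆R′ = Reach-closed (λ a∈⁅s⁆ _ → ⁅⁆⊆ s∈R′ a∈⁅s⁆) closed′ ∘ proj₁ (isR″ _)

lemma6 : ∀ {h n} (H : Graph h) → Bipartite H →
    (G : Graph n) (L : Fin n → Subset h) (N₀ : Subset n) (k : ℕ) →
    (∀ v → FSFC H (L v)) →
    (W : Subset n) → MinSolution H G L N₀ k W →
    (R : Subset (suc n)) → IsReachSet (addApex G N₀) (lift W) ⁅ s ⁆ R →
    (∀ W' R' → MinSolution H G L N₀ k W' →
       IsReachSet (addApex G N₀) (lift W') ⁅ s ⁆ R' → ∣ R ∣ ≤ ∣ R' ∣) →
    (lift W ≡ nbhd (addApex G N₀) R) × Closest (addApex G N₀) ⁅ s ⁆ R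
lemma6 H _ G L N₀ k _ W minW R isR minR = W≡N , reachSet-closest H G L N₀ minW isR W≡N minR
  where
  W≡N : lift W ≡ nbhd (addApex G N₀) R
  W≡N = ⊆-antisym (MinSolution-⊆-nbhd H G L N₀ minW isR) (nbhd-⊆ {K = addApex G N₀} (IsReachSet-closed isR))
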